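{- Let $\mathcal C$ be either $\mathcal C_1$ or $\mathcal C_2$ (defined in the context) and start from the configuration with $c_{0,0}=1$ and all other cells $0$. Then for every $k\ge 0$ the number $\mathcal N_k$ of cells with value $1$ after $k$ steps equals $4^{\ell(k)}$, where $\ell(k)$ is the number of ones in the binary expansion of $k$.
   Context: Cells are indexed by $(i,j)\in\mathbb Z^2$ with states in $\{0,1\}$. $\mathcal C_1$ is the cellular automaton with synchronous local rule $c_{i,j}\mapsto c_{i-1,j-1}+c_{i-1,j+1}+c_{i+1,j-1}+c_{i+1,j+1}\bmod 2$; $\mathcal C_2$ has rule $c_{i,j}\mapsto c_{i,j-1}+c_{i,j+1}+c_{i+1,j}+c_{i-1,j}\bmod 2$. -}

module Defs where

open import Data.Bool using (Bool; true; false; _xor_)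
open import Data.Nat using (ℕ; zero; suc; _+_; _^_)
open import Data.Nat.DivMod using (_/_; _%_)
open import Data.Integer using (ℤ; +_) renaming (_-_ to _-ℤ_; _+_ to _+ℤ_)
open import Data.Product using (_×_; _,_; Σ)
open import Data.List using (List; length)
open import Data.List.Membership.Propositional using (_∈_)
open import Data.List.Relation.Unary.Unique.Propositional using (Unique)
open import Relation.Binary.PropositionalEquality using (_≡_)
open import Function.Bundles using (_⇔_)

-- A configuration: state of cell (i , j) ∈ ℤ², with {0,1} encoded as Bool
-- (true = 1, false = 0); addition mod 2 is xor.
Config : Set
Config = ℤ → ℤ → Bool

step₁ : Config → Config
step₁ c i j = c (i -ℤ + 1) (j -ℤ + 1) xor c (i -ℤ + 1) (j +ℤ + 1)
          xor c (i +ℤ + 1) (j -ℤ + 1) xor c (i +ℤ + 1) (j +ℤ + 1)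

step₂ : Config → Config
step₂ c i j = c i (j -ℤ + 1) xor c i (j +ℤ + 1)
          xor c (i +ℤ + 1) j xor c (i -ℤ + 1) j

data Automaton : Set where
  𝒞₁ 𝒞₂ : Automaton

step : Automaton → Config → Config
step 𝒞₁ = step₁
step 𝒞₂ = step₂

iterate : (Config → Config) → ℕ → Config → Config
iterate f zero    c = c
iterate f (suc k) c = f (iterate f k c)

isZero : ℤ → Bool
isZero (+ zero) = true
isZero _        = false

initial : Config
initial i j with isZero i | isZero j
... | true | true = true
... | _    | _    = false

-- "the set of cells with value 1 in c is finite and has exactly n elements":
-- there is a duplicate-free list enumerating exactly those cells, of length n.
NumOnes : Config → ℕ → Set
NumOnes c n = Σ (List (ℤ × ℤ)) λ L →
  Unique L × ((∀ i j → (c i j ≡ true) ⇔ ((i , j) ∈ L)) × length L ≡ n)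

-- number of ones in the binary expansion of k; the fuel argument (k itself)
-- always suffices since k has at most k binary digits.
onesAux : ℕ → ℕ → ℕ
onesAux zero    m = 0
onesAux (suc f) m = m % 2 + onesAux f (m / 2)

ℓ : ℕ → ℕ
ℓ k = onesAux k k

module Submission where

-- Both automata reduce to the one-dimensional rule 90, rule90 a x = a (x - 1) + a (x + 1)
-- (mod 2).  Let row k be the k-th iterate of rule 90 on a single one at 0.  Since ∧
-- distributes over xor, 𝒞₁ maps the product a(i)a(j) to the same product built from
-- rule90 a, and 𝒞₂ does so for the rotated product a(i + j)a(i - j) (lift, step-lift).
-- After k steps the configuration is thus the (rotated) square of row k, whose ones
-- form a grid indexed by pairs of ones of row k; so it suffices that row k has
-- 2 ^ ℓ k ones (RowCensus).  In characteristic 2, two steps of rule 90 are one step at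
-- distance 2 (rule90-twice), so row (2m) is row m dilated by 2 (row-double), and
-- row (2m + 1) applies rule 90 to that dilation, which doubles the number of ones
-- since ones of row m are never adjacent (centred-sparse, lists-rule90).  Induction
-- along the binary expansion of k (Binary), with ℓ (2m) = ℓ m and ℓ (2m + 1) = 1 + ℓ m,
-- counts the ones of row k; the grid then has (2 ^ ℓ k)² = 4 ^ ℓ k cells.

open import Defs
open import Data.Nat as ℕ using (ℕ; zero; suc; _^_; z≤n; s≤s)
import Data.Nat.Properties as ℕP
open import Data.Nat.DivMod using (_%_; _/_; m*n%n≡0; m*n/n≡m; m/n<m; [m+kn]%n≡m%n; +-distrib-/)
import Data.Nat.Tactic.RingSolver as ℕSolver
open import Data.Integer using (ℤ; +_; -[1+_]; _+_; _-_; -_; _*_; ∣_∣)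
import Data.Integer.Properties as ℤP
open import Algebra.Properties.AbelianGroup ℤP.+-0-abelianGroup using (∙-cancelʳ)
open import Data.Integer.DivMod using (_%ℕ_; _/ℕ_; n%ℕd<d; a≡a%ℕn+[a/ℕn]*n)
open import Data.Integer.Tactic.RingSolver using (solve; solve-∀)
open import Data.Bool using (Bool; true; false; _xor_; _∧_)
open import Data.Bool.Properties using (xor-identityʳ; xor-comm; xor-annihilates-not)
open import Data.Bool.Solver using (module xor-∧-Solver)
open import Data.Product using (_×_; _,_; proj₁; proj₂)
open import Data.Sum using (inj₁; inj₂)
open import Data.Empty using (⊥-elim)
open import Data.List using (List; []; _∷_; map; _++_; length; cartesianProductWith)
open import Data.List.Properties using (map-∘; map-cong; map-++; length-map; length-++)
open import Data.List.Membership.Propositional using (_∈_)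
open import Data.List.Membership.Propositional.Properties
  using (∈-map⁺; ∈-map⁻; ∈-++⁺ˡ; ∈-++⁺ʳ; ∈-++⁻; ∈-cartesianProductWith⁺; ∈-cartesianProductWith⁻)
open import Data.List.Relation.Unary.Any using (here)
open import Data.List.Relation.Unary.All using ([])
open import Data.List.Relation.Unary.AllPairs using ([]; _∷_)
open import Data.List.Relation.Unary.Unique.Propositional using (Unique)
open import Data.List.Relation.Unary.Unique.Propositional.Properties using (map⁺; ++⁺; cartesianProductWith⁺)
open import Function using (_∘_)
open import Function.Bundles using (_⇔_; mk⇔; Equivalence)
open import Function.Construct.Composition using (_⇔-∘_)
open import Function.Construct.Symmetry using (⇔-sym)
open import Relation.Nullary using (¬_)
open import Relation.Binary.PropositionalEquality
open ≡-Reasoning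

open Equivalence using (to; from)

true≢false : true ≢ false
true≢false ()

∧-true : ∀ {a b} → a ∧ b ≡ true → a ≡ true × b ≡ true
∧-true {true} {true} _ = refl , refl

Bool-ext : ∀ {b c} → (b ≡ true ⇔ c ≡ true) → b ≡ c
Bool-ext {true} b⇔c = sym (to b⇔c refl)
Bool-ext {false} {true} b⇔c = from b⇔c refl
Bool-ext {false} {false} _ = refl

xor-cancel-middle : ∀ x y z → (x xor y) xor (y xor z) ≡ x xor z
xor-cancel-middle x false z = cong (_xor z) (xor-identityʳ x)
xor-cancel-middle x true z = trans (cong (_xor _) (xor-comm x true)) (xor-annihilates-not x z)

-- Distributivity of ∧ over xor, in the two term orders in which the
-- neighbourhoods of 𝒞₁ and 𝒞₂ produce the four products.
module _ where
  open xor-∧-Solver using (_:+_; _:*_; _:=_) renaming (solve to solveBool)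

  ∧-xor-expand₁ : ∀ a b c d → (a xor b) ∧ (c xor d) ≡ a ∧ c xor a ∧ d xor b ∧ c xor b ∧ d
  ∧-xor-expand₁ = solveBool 4 (λ a b c d →
    (a :+ b) :* (c :+ d) := a :* c :+ (a :* d :+ (b :* c :+ b :* d))) refl

  ∧-xor-expand₂ : ∀ a b c d → (a xor b) ∧ (c xor d) ≡ a ∧ d xor b ∧ c xor b ∧ d xor a ∧ c
  ∧-xor-expand₂ = solveBool 4 (λ a b c d →
    (a :+ b) :* (c :+ d) := a :* d :+ (b :* c :+ (b :* d :+ a :* c))) refl

even≢odd : ∀ x y → + 2 * x ≢ + 2 * y + + 1
even≢odd x y 2x≡2y+1 =
  2≢1 (ℕP.m*n≡1⇒m≡1 2 ∣ x - y ∣ (trans (sym (ℤP.abs-* (+ 2) (x - y))) (cong ∣_∣ twice-difference)))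
  where
  2≢1 : 2 ≢ 1
  2≢1 ()
  twice-difference : + 2 * (x - y) ≡ + 1
  twice-difference = begin
    + 2 * (x - y)               ≡⟨ solve (x ∷ y ∷ []) ⟩
    + 2 * x - + 2 * y           ≡⟨ cong (_- + 2 * y) 2x≡2y+1 ⟩
    + 2 * y + + 1 - + 2 * y     ≡⟨ solve (y ∷ []) ⟩
    + 1                         ∎

data Parity : ℤ → Set where
  even : ∀ h → Parity (+ 2 * h)
  odd  : ∀ h → Parity (+ 2 * h + + 1)

parity : ∀ x → Parity x
parity x = subst Parity (sym (a≡a%ℕn+[a/ℕn]*n x 2)) (remainder (x %ℕ 2) (x /ℕ 2) (n%ℕd<d x 2))
  where
  remainder : ∀ r h → r ℕ.< 2 → Parity (+ r + h * + 2)
  remainder 0 h _ = subst Parity (trans (ℤP.*-comm (+ 2) h) (sym (ℤP.+-identityˡ _))) (even h)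
  remainder 1 h _ = subst Parity
    (trans (ℤP.+-comm (+ 2 * h) (+ 1)) (cong (λ y → + 1 + y) (ℤP.*-comm (+ 2) h))) (odd h)
  remainder (suc (suc _)) _ (s≤s (s≤s ()))

double-injective : ∀ {t u} → + 2 * t ≡ + 2 * u → t ≡ u
double-injective {t} {u} = ℤP.*-cancelˡ-≡ (+ 2) t u

double+1-injective : ∀ {t u} → + 2 * t + + 1 ≡ + 2 * u + + 1 → t ≡ u
double+1-injective {t} {u} = double-injective ∘ ∙-cancelʳ (+ 1) (+ 2 * t) (+ 2 * u)

-- The ones of row k of rule 90 sit at the centred positions 2t - k.
centre : ℤ → ℤ → ℤ
centre K t = + 2 * t - K

centre-injective : ∀ K {t u} → centre K t ≡ centre K u → t ≡ u
centre-injective K {t} {u} = double-injective ∘ ∙-cancelʳ (- K) (+ 2 * t) (+ 2 * u)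

isZero≡true : ∀ {x} → isZero x ≡ true → x ≡ + 0
isZero≡true {+ zero} _ = refl

onesAux-zero : ∀ f → onesAux f 0 ≡ 0
onesAux-zero zero    = refl
onesAux-zero (suc f) = onesAux-zero f

onesAux-fuel : ∀ f g m → m ℕ.≤ f → m ℕ.≤ g → onesAux f m ≡ onesAux g m
onesAux-fuel zero    g       0 z≤n _   = sym (onesAux-zero g)
onesAux-fuel (suc f) zero    0 _   z≤n = onesAux-zero (suc f)
onesAux-fuel (suc f) (suc g) m m≤f m≤g =
  cong (m % 2 ℕ.+_) (onesAux-fuel f g (m / 2) (half-≤ m m≤f) (half-≤ m m≤g))
  where
  half-≤ : ∀ n {k} → n ℕ.≤ suc k → n / 2 ℕ.≤ k
  half-≤ zero    _      = z≤n
  half-≤ (suc n) n≤1+k  = ℕP.≤-pred (ℕP.≤-trans (m/n<m (suc n) 2 (s≤s (s≤s z≤n))) n≤1+k)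

ℓ-unfold : ∀ n → ℓ n ≡ n % 2 ℕ.+ ℓ (n / 2)
ℓ-unfold zero    = refl
ℓ-unfold (suc f) = cong (suc f % 2 ℕ.+_)
  (onesAux-fuel f (suc f / 2) (suc f / 2) (ℕP.≤-pred (m/n<m (suc f) 2 (s≤s (s≤s z≤n)))) ℕP.≤-refl)

ℓ-double : ∀ m → ℓ (m ℕ.* 2) ≡ ℓ m
ℓ-double m = trans (ℓ-unfold (m ℕ.* 2)) (cong₂ ℕ._+_ (m*n%n≡0 m 2) (cong ℓ (m*n/n≡m m 2)))

ℓ-double+1 : ∀ m → ℓ (suc (m ℕ.* 2)) ≡ suc (ℓ m)
ℓ-double+1 m = trans (ℓ-unfold (suc (m ℕ.* 2))) (cong₂ ℕ._+_ ([m+kn]%n≡m%n 1 m 2) (cong ℓ half))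
  where
  half : suc (m ℕ.* 2) / 2 ≡ m
  half = trans (+-distrib-/ 1 (m ℕ.* 2) (subst (λ r → 1 ℕ.+ r ℕ.< 2) (sym (m*n%n≡0 m 2)) (s≤s (s≤s z≤n))))
               (m*n/n≡m m 2)

data Binary : ℕ → Set where
  0b  : Binary 0
  _·0 : ∀ {m} → Binary m → Binary (m ℕ.* 2)
  _·1 : ∀ {m} → Binary m → Binary (suc (m ℕ.* 2))

binary-suc : ∀ {k} → Binary k → Binary (suc k)
binary-suc 0b     = 0b ·1
binary-suc (b ·0) = b ·1
binary-suc (b ·1) = binary-suc b ·0

binary : ∀ k → Binary k
binary zero    = 0b
binary (suc k) = binary-suc (binary k)

rule90 : (ℤ → Bool) → ℤ → Bool
rule90 a x = a (x - + 1) xor a (x + + 1)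

-- row k: the orbit of a single one under rule 90 (Pascal's triangle mod 2)
row : ℕ → ℤ → Bool
row zero    = isZero
row (suc k) = rule90 (row k)

rule90-twice : ∀ b x → rule90 (rule90 b) x ≡ b (x - + 2) xor b (x + + 2)
rule90-twice b x = begin
  (b (x - + 1 - + 1) xor b (x - + 1 + + 1)) xor (b (x + + 1 - + 1) xor b (x + + 1 + + 1))
    ≡⟨ cong₂ _xor_ (cong₂ _xor_ (cong b (solve (x ∷ []))) (cong b (solve (x ∷ []))))
                   (cong₂ _xor_ (cong b (solve (x ∷ []))) (cong b (solve (x ∷ [])))) ⟩
  (b (x - + 2) xor b x) xor (b x xor b (x + + 2))
    ≡⟨ xor-cancel-middle (b (x - + 2)) (b x) (b (x + + 2)) ⟩
  b (x - + 2) xor b (x + + 2) ∎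

record Dilation (a b : ℤ → Bool) : Set where
  field
    at-even : ∀ h → b (+ 2 * h) ≡ a h
    at-odd  : ∀ h → b (+ 2 * h + + 1) ≡ false

module _ {a b : ℤ → Bool} (d : Dilation a b) where

  dilation-even : ∀ {x} h → x ≡ + 2 * h → b x ≡ a h
  dilation-even h refl = Dilation.at-even d h

  dilation-odd : ∀ {x} h → x ≡ + 2 * h + + 1 → b x ≡ false
  dilation-odd h refl = Dilation.at-odd d h

  -- Dilation commutes with rule 90, two steps upstairs being one downstairs.
  rule90²-dilation : Dilation (rule90 a) (rule90 (rule90 b))
  rule90²-dilation = record { at-even = at-even ; at-odd = at-odd }
    where
    at-even : ∀ h → rule90 (rule90 b) (+ 2 * h) ≡ rule90 a h
    at-even h = begin
      rule90 (rule90 b) (+ 2 * h)               ≡⟨ rule90-twice b (+ 2 * h) ⟩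
      b (+ 2 * h - + 2) xor b (+ 2 * h + + 2)   ≡⟨ cong₂ _xor_ (dilation-even (h - + 1) (solve (h ∷ [])))
                                                               (dilation-even (h + + 1) (solve (h ∷ []))) ⟩
      rule90 a h                                ∎
    at-odd : ∀ h → rule90 (rule90 b) (+ 2 * h + + 1) ≡ false
    at-odd h = begin
      rule90 (rule90 b) (+ 2 * h + + 1)                     ≡⟨ rule90-twice b (+ 2 * h + + 1) ⟩
      b (+ 2 * h + + 1 - + 2) xor b (+ 2 * h + + 1 + + 2)   ≡⟨ cong₂ _xor_ (dilation-odd (h - + 1) (solve (h ∷ [])))
                                                                           (dilation-odd (h + + 1) (solve (h ∷ []))) ⟩
      false                                                 ∎

isZero-dilation : Dilation isZero isZero
isZero-dilation = record { at-even = at-even ; at-odd = at-odd }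
  where
  at-even : ∀ h → isZero (+ 2 * h) ≡ isZero h
  at-even (+ zero)    = refl
  at-even (+ suc _)   = refl
  at-even -[1+ _ ]   = refl
  at-odd : ∀ h → isZero (+ 2 * h + + 1) ≡ false
  at-odd h with isZero (+ 2 * h + + 1) in odd-is-zero
  ... | false = refl
  ... | true  = ⊥-elim (even≢odd (+ 0) h (sym (isZero≡true odd-is-zero)))

row-double : ∀ m → Dilation (row m) (row (m ℕ.* 2))
row-double zero    = isZero-dilation
row-double (suc m) = rule90²-dilation (row-double m)

-- L lists exactly the ones of a (possibly with repetitions).
Lists : (ℤ → Bool) → List ℤ → Set
Lists a L = ∀ x → a x ≡ true ⇔ x ∈ L

∈-map-at : ∀ {f : ℤ → ℤ} {L x y} → y ∈ L → x ≡ f y → x ∈ map f L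
∈-map-at {f} y∈L refl = ∈-map⁺ f y∈L

lists-dilation : ∀ {a b L} → Dilation a b → Lists a L → Lists b (map (+ 2 *_) L)
lists-dilation {b = b} {L} d ones x = mk⇔ (ones-are-listed x) (listed-are-ones x)
  where
  ones-are-listed : ∀ x → b x ≡ true → x ∈ map (+ 2 *_) L
  ones-are-listed x bx with parity x
  ... | even h = ∈-map⁺ (+ 2 *_) (to (ones h) (trans (sym (Dilation.at-even d h)) bx))
  ... | odd h  = ⊥-elim (true≢false (trans (sym bx) (Dilation.at-odd d h)))
  listed-are-ones : ∀ x → x ∈ map (+ 2 *_) L → b x ≡ true
  listed-are-ones x x∈ with ∈-map⁻ (+ 2 *_) x∈
  ... | h , h∈L , refl = trans (Dilation.at-even d h) (from (ones h) h∈L)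

NoOnesAtDistance2 : (ℤ → Bool) → Set
NoOnesAtDistance2 a = ∀ x → a (x - + 1) ≡ true → a (x + + 1) ≡ false

-- If no two ones are at distance 2, rule 90 moves every one both one step
-- left and one step right without any cancellation.
lists-rule90 : ∀ {a L} → NoOnesAtDistance2 a → Lists a L →
               Lists (rule90 a) (map (_- + 1) L ++ map (_+ + 1) L)
lists-rule90 {a} {L} gap ones x = mk⇔ (ones-are-listed x) (listed-are-ones x)
  where
  step-back : ∀ y → y + + 1 - + 1 ≡ y
  step-back y = solve (y ∷ [])
  step-forth : ∀ y → y - + 1 + + 1 ≡ y
  step-forth y = solve (y ∷ [])

  gap⁻ : ∀ x → a (x + + 1) ≡ true → a (x - + 1) ≡ false
  gap⁻ x right with a (x - + 1) in left
  ... | false = refl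
  ... | true  = ⊥-elim (true≢false (trans (sym right) (gap x left)))

  ones-are-listed : ∀ x → rule90 a x ≡ true → x ∈ map (_- + 1) L ++ map (_+ + 1) L
  ones-are-listed x r with a (x - + 1) in left
  ... | true  = ∈-++⁺ʳ (map (_- + 1) L) (∈-map-at (to (ones _) left) (sym (step-forth x)))
  ... | false = ∈-++⁺ˡ (∈-map-at (to (ones _) r) (sym (step-back x)))

  listed-are-ones : ∀ x → x ∈ map (_- + 1) L ++ map (_+ + 1) L → rule90 a x ≡ true
  listed-are-ones x x∈ with ∈-++⁻ (map (_- + 1) L) x∈
  ... | inj₁ x∈₋ with ∈-map⁻ (_- + 1) x∈₋
  ...   | y , y∈L , refl = cong₂ _xor_ (gap⁻ (y - + 1) a-right) a-right
    where
    a-right : a (y - + 1 + + 1) ≡ true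
    a-right = trans (cong a (step-forth y)) (from (ones y) y∈L)
  listed-are-ones x x∈ | inj₂ x∈₊ with ∈-map⁻ (_+ + 1) x∈₊
  ...   | y , y∈L , refl = cong₂ _xor_ a-left (gap (y + + 1) a-left)
    where
    a-left : a (y + + 1 - + 1) ≡ true
    a-left = trans (cong a (step-back y)) (from (ones y) y∈L)

Sparse : (ℤ → Bool) → Set
Sparse a = ∀ x → a x ≡ true → a (x + + 1) ≡ false

-- Ones at centred positions 2t - K all have the parity of K.
centred-sparse : ∀ {a K T} → Lists a (map (centre K) T) → Sparse a
centred-sparse {a} {K} ones x ax with a (x + + 1) in ax+1
... | false = refl
... | true with ∈-map⁻ (centre K) (to (ones x) ax) | ∈-map⁻ (centre K) (to (ones (x + + 1)) ax+1)
...   | t , _ , x≡ | u , _ , x+1≡ = ⊥-elim (even≢odd u t (begin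
  + 2 * u                 ≡⟨ solve (u ∷ K ∷ []) ⟩
  + 2 * u - K + K         ≡⟨ cong (_+ K) (sym x+1≡) ⟩
  x + + 1 + K             ≡⟨ cong (λ y → y + + 1 + K) x≡ ⟩
  + 2 * t - K + + 1 + K   ≡⟨ solve (t ∷ K ∷ []) ⟩
  + 2 * t + + 1           ∎))

dilation-gap : ∀ {a b} → Dilation a b → Sparse a → NoOnesAtDistance2 b
dilation-gap {a} {b} d sparse x bx-1 with parity x
... | even h = ⊥-elim (true≢false (trans (sym bx-1) (dilation-odd d (h - + 1) 2h-1≡2[h-1]+1)))
  where
  2h-1≡2[h-1]+1 : + 2 * h - + 1 ≡ + 2 * (h - + 1) + + 1
  2h-1≡2[h-1]+1 = solve (h ∷ [])
... | odd h  = begin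
  b (+ 2 * h + + 1 + + 1)   ≡⟨ dilation-even d (h + + 1) (solve (h ∷ [])) ⟩
  a (h + + 1)               ≡⟨ sparse h (trans (sym (dilation-even d h 2h+1-1≡2h)) bx-1) ⟩
  false                     ∎
  where
  2h+1-1≡2h : + 2 * h + + 1 - + 1 ≡ + 2 * h
  2h+1-1≡2h = solve (h ∷ [])

map-square : ∀ {f g f′ g′ : ℤ → ℤ} → (∀ t → f (g t) ≡ f′ (g′ t)) →
             ∀ T → map f (map g T) ≡ map f′ (map g′ T)
map-square {f} {g} {f′} {g′} commutes T = begin
  map f (map g T)     ≡⟨ map-∘ T ⟨
  map (f ∘ g) T       ≡⟨ map-cong commutes T ⟩
  map (f′ ∘ g′) T     ≡⟨ map-∘ T ⟩
  map f′ (map g′ T)   ∎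

module _ (m : ℕ) (t : ℤ) where
  private
    M : ℤ
    M = + m

    2m≡ : + (m ℕ.* 2) ≡ M + M
    2m≡ = trans (cong +_ m*2≡m+m) (ℤP.pos-+ m m)
      where
      m*2≡m+m : m ℕ.* 2 ≡ m ℕ.+ m
      m*2≡m+m = ℕSolver.solve (m ∷ [])

    2m+1≡ : + suc (m ℕ.* 2) ≡ + 1 + (M + M)
    2m+1≡ = trans (ℤP.pos-+ 1 (m ℕ.* 2)) (cong (λ y → + 1 + y) 2m≡)

    centre′ : ℤ → ℤ → ℤ
    centre′ t K = centre K t

    shift-even : ∀ t M → + 2 * (+ 2 * t - M) ≡ + 2 * (+ 2 * t) - (M + M)
    shift-even = solve-∀

    shift-even-1 : ∀ t M → + 2 * (+ 2 * t - M) - + 1 ≡ + 2 * (+ 2 * t) - (+ 1 + (M + M))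
    shift-even-1 = solve-∀

    shift-odd : ∀ t M → + 2 * (+ 2 * t - M) + + 1 ≡ + 2 * (+ 2 * t + + 1) - (+ 1 + (M + M))
    shift-odd = solve-∀

  centre-double : + 2 * centre M t ≡ centre (+ (m ℕ.* 2)) (+ 2 * t)
  centre-double = begin
    + 2 * (+ 2 * t - M)               ≡⟨ shift-even t M ⟩
    + 2 * (+ 2 * t) - (M + M)         ≡⟨ cong (centre′ (+ 2 * t)) 2m≡ ⟨
    + 2 * (+ 2 * t) - + (m ℕ.* 2)     ∎

  centre-double-1 : + 2 * centre M t - + 1 ≡ centre (+ suc (m ℕ.* 2)) (+ 2 * t)
  centre-double-1 = begin
    + 2 * (+ 2 * t - M) - + 1             ≡⟨ shift-even-1 t M ⟩
    + 2 * (+ 2 * t) - (+ 1 + (M + M))     ≡⟨ cong (centre′ (+ 2 * t)) 2m+1≡ ⟨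
    + 2 * (+ 2 * t) - + suc (m ℕ.* 2)     ∎

  centre-double+1 : + 2 * centre M t + + 1 ≡ centre (+ suc (m ℕ.* 2)) (+ 2 * t + + 1)
  centre-double+1 = begin
    + 2 * (+ 2 * t - M) + + 1                   ≡⟨ shift-odd t M ⟩
    + 2 * (+ 2 * t + + 1) - (+ 1 + (M + M))     ≡⟨ cong (centre′ (+ 2 * t + + 1)) 2m+1≡ ⟨
    + 2 * (+ 2 * t + + 1) - + suc (m ℕ.* 2)     ∎

record RowCensus (k : ℕ) : Set where
  field
    indices : List ℤ
    unique  : Unique indices
    size    : length indices ≡ 2 ^ ℓ k
    ones    : Lists (row k) (map (centre (+ k)) indices)

census-zero : RowCensus 0
census-zero = record
  { indices = + 0 ∷ []
  ; unique  = [] ∷ []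
  ; size    = refl
  ; ones    = λ x → mk⇔ (λ x-is-zero → here (isZero≡true x-is-zero)) (λ { (here refl) → refl })
  }

census-double : ∀ {m} → RowCensus m → RowCensus (m ℕ.* 2)
census-double {m} c = record
  { indices = map (+ 2 *_) indices
  ; unique  = map⁺ double-injective unique
  ; size    = trans (length-map (+ 2 *_) indices) (trans size (cong (2 ^_) (sym (ℓ-double m))))
  ; ones    = subst (Lists (row (m ℕ.* 2))) (map-square (centre-double m) indices)
                    (lists-dilation (row-double m) ones)
  }
  where open RowCensus c

census-double+1 : ∀ {m} → RowCensus m → RowCensus (suc (m ℕ.* 2))
census-double+1 {m} c = record
  { indices = evens ++ odds
  ; unique  = ++⁺ (map⁺ double-injective unique) (map⁺ double+1-injective unique) evens-odds-disjoint
  ; size    = begin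
      length (evens ++ odds)                ≡⟨ length-++ evens ⟩
      length evens ℕ.+ length odds          ≡⟨ cong₂ ℕ._+_ (length-map _ indices) (length-map _ indices) ⟩
      length indices ℕ.+ length indices     ≡⟨ cong₂ ℕ._+_ size size ⟩
      2 ^ ℓ m ℕ.+ 2 ^ ℓ m                   ≡⟨ cong (2 ^ ℓ m ℕ.+_) (ℕP.+-identityʳ (2 ^ ℓ m)) ⟨
      2 ^ suc (ℓ m)                         ≡⟨ cong (2 ^_) (ℓ-double+1 m) ⟨
      2 ^ ℓ (suc (m ℕ.* 2))                 ∎
  ; ones    = subst (Lists (row (suc (m ℕ.* 2)))) ones-positions
                    (lists-rule90 (dilation-gap (row-double m) (centred-sparse ones))
                                  (lists-dilation (row-double m) ones))
  }
  where
  open RowCensus c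
  evens odds : List ℤ
  evens = map (+ 2 *_) indices
  odds  = map (λ t → + 2 * t + + 1) indices

  evens-odds-disjoint : ∀ {v} → ¬ (v ∈ evens × v ∈ odds)
  evens-odds-disjoint (v∈evens , v∈odds) with ∈-map⁻ _ v∈evens | ∈-map⁻ _ v∈odds
  ... | t , _ , refl | u , _ , 2t≡2u+1 = even≢odd t u 2t≡2u+1

  M : ℤ
  M = + suc (m ℕ.* 2)

  doubled : List ℤ
  doubled = map (+ 2 *_) (map (centre (+ m)) indices)

  ones-positions : map (_- + 1) doubled ++ map (_+ + 1) doubled ≡ map (centre M) (evens ++ odds)
  ones-positions = begin
    map (_- + 1) doubled ++ map (_+ + 1) doubled
      ≡⟨ cong₂ _++_ (map-∘ (map (centre (+ m)) indices)) (map-∘ (map (centre (+ m)) indices)) ⟨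
    map ((_- + 1) ∘ (+ 2 *_)) (map (centre (+ m)) indices) ++ map ((_+ + 1) ∘ (+ 2 *_)) (map (centre (+ m)) indices)
      ≡⟨ cong₂ _++_ (map-square (centre-double-1 m) indices) (map-square (centre-double+1 m) indices) ⟩
    map (centre M) evens ++ map (centre M) odds
      ≡⟨ map-++ (centre M) evens odds ⟨
    map (centre M) (evens ++ odds) ∎

census : ∀ {k} → Binary k → RowCensus k
census 0b     = census-zero
census (b ·0) = census-double (census b)
census (b ·1) = census-double+1 (census b)

_≗₂_ : Config → Config → Set
c ≗₂ c′ = ∀ i j → c i j ≡ c′ i j

step-cong : ∀ 𝒞 {c c′} → c ≗₂ c′ → step 𝒞 c ≗₂ step 𝒞 c′
step-cong 𝒞₁ c≗c′ i j = cong₂ _xor_ (c≗c′ _ _) (cong₂ _xor_ (c≗c′ _ _) (cong₂ _xor_ (c≗c′ _ _) (c≗c′ _ _)))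
step-cong 𝒞₂ c≗c′ i j = cong₂ _xor_ (c≗c′ _ _) (cong₂ _xor_ (c≗c′ _ _) (cong₂ _xor_ (c≗c′ _ _) (c≗c′ _ _)))

-- The configurations on which 𝒞 acts as rule 90: products a(i)a(j) for 𝒞₁
-- and rotated products a(i + j)a(i - j) for 𝒞₂.
lift : Automaton → (ℤ → Bool) → Config
lift 𝒞₁ a i j = a i ∧ a j
lift 𝒞₂ a i j = a (i + j) ∧ a (i - j)

-- On lifted rows, one step of 𝒞 is one step of rule 90 (distributivity of ∧ over xor).
step-lift : ∀ 𝒞 a → step 𝒞 (lift 𝒞 a) ≗₂ lift 𝒞 (rule90 a)
step-lift 𝒞₁ a i j = sym (∧-xor-expand₁ (a (i - + 1)) (a (i + + 1)) (a (j - + 1)) (a (j + + 1)))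
step-lift 𝒞₂ a i j = begin
  a (i + (j - + 1)) ∧ a (i - (j - + 1)) xor a (i + (j + + 1)) ∧ a (i - (j + + 1)) xor
  a (i + + 1 + j) ∧ a (i + + 1 - j) xor a (i - + 1 + j) ∧ a (i - + 1 - j)
    ≡⟨ cong₂ _xor_ (cong₂ _∧_ (cong a (solve (i ∷ j ∷ []))) (cong a (solve (i ∷ j ∷ []))))
      (cong₂ _xor_ (cong₂ _∧_ (cong a (solve (i ∷ j ∷ []))) (cong a (solve (i ∷ j ∷ []))))
      (cong₂ _xor_ (cong₂ _∧_ (cong a (solve (i ∷ j ∷ []))) (cong a (solve (i ∷ j ∷ []))))
                   (cong₂ _∧_ (cong a (solve (i ∷ j ∷ []))) (cong a (solve (i ∷ j ∷ [])))))) ⟩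
  a (i + j - + 1) ∧ a (i - j + + 1) xor a (i + j + + 1) ∧ a (i - j - + 1) xor
  a (i + j + + 1) ∧ a (i - j + + 1) xor a (i + j - + 1) ∧ a (i - j - + 1)
    ≡⟨ ∧-xor-expand₂ (a (i + j - + 1)) (a (i + j + + 1)) (a (i - j - + 1)) (a (i - j + + 1)) ⟨
  lift 𝒞₂ (rule90 a) i j ∎

iterate-lift : ∀ 𝒞 → initial ≗₂ lift 𝒞 isZero → ∀ k → iterate (step 𝒞) k initial ≗₂ lift 𝒞 (row k)
iterate-lift 𝒞 initial-lift zero = initial-lift
iterate-lift 𝒞 initial-lift (suc k) i j =
  trans (step-cong 𝒞 (iterate-lift 𝒞 initial-lift k) i j) (step-lift 𝒞 (row k) i j)

-- The ones of a lifted row form a grid, indexed by pairs of indices of the row.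
grid : Automaton → ℤ → ℤ → ℤ → ℤ × ℤ
grid 𝒞₁ K t u = centre K t , centre K u
grid 𝒞₂ K t u = t + u - K , t - u

rotation : ∀ i j → + 2 * i ≡ (i + j) + (i - j) × + 2 * j ≡ (i + j) - (i - j)
rotation i j = solve (i ∷ j ∷ []) , solve (i ∷ j ∷ [])

grid-rotation : ∀ K t u → (t + u - K) + (t - u) ≡ + 2 * t - K × (t + u - K) - (t - u) ≡ + 2 * u - K
grid-rotation K t u = solve (K ∷ t ∷ u ∷ []) , solve (K ∷ t ∷ u ∷ [])

centre-rotation : ∀ K t u → (+ 2 * t - K) + (+ 2 * u - K) ≡ + 2 * (t + u - K) ×
                            (+ 2 * t - K) - (+ 2 * u - K) ≡ + 2 * (t - u)
centre-rotation K t u = solve (K ∷ t ∷ u ∷ []) , solve (K ∷ t ∷ u ∷ [])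

grid-injective : ∀ 𝒞 K {t t′ u u′} → grid 𝒞 K t u ≡ grid 𝒞 K t′ u′ → t ≡ t′ × u ≡ u′
grid-injective 𝒞₁ K eq = centre-injective K (cong proj₁ eq) , centre-injective K (cong proj₂ eq)
grid-injective 𝒞₂ K {t} {t′} {u} {u′} eq =
  centre-injective K (begin
    centre K t                     ≡⟨ proj₁ (grid-rotation K t u) ⟨
    (t + u - K) + (t - u)          ≡⟨ cong₂ _+_ (cong proj₁ eq) (cong proj₂ eq) ⟩
    (t′ + u′ - K) + (t′ - u′)      ≡⟨ proj₁ (grid-rotation K t′ u′) ⟩
    centre K t′                    ∎) ,
  centre-injective K (begin
    centre K u                     ≡⟨ proj₂ (grid-rotation K t u) ⟨
    (t + u - K) - (t - u)          ≡⟨ cong₂ _-_ (cong proj₁ eq) (cong proj₂ eq) ⟩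
    (t′ + u′ - K) - (t′ - u′)      ≡⟨ proj₂ (grid-rotation K t′ u′) ⟩
    centre K u′                    ∎)

lift-ones : ∀ 𝒞 {a K T} → Lists a (map (centre K) T) →
            ∀ i j → lift 𝒞 a i j ≡ true ⇔ (i , j) ∈ cartesianProductWith (grid 𝒞 K) T T
lift-ones 𝒞₁ {a} {K} {T} ones i j = mk⇔ (ones-are-listed i j) (listed-are-ones i j)
  where
  ones-are-listed : ∀ i j → a i ∧ a j ≡ true → (i , j) ∈ cartesianProductWith (grid 𝒞₁ K) T T
  ones-are-listed i j aij with ∈-map⁻ (centre K) (to (ones i) (proj₁ (∧-true aij)))
                            | ∈-map⁻ (centre K) (to (ones j) (proj₂ (∧-true aij)))
  ... | t , t∈T , refl | u , u∈T , refl = ∈-cartesianProductWith⁺ (grid 𝒞₁ K) t∈T u∈T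
  listed-are-ones : ∀ i j → (i , j) ∈ cartesianProductWith (grid 𝒞₁ K) T T → a i ∧ a j ≡ true
  listed-are-ones i j ij∈ with ∈-cartesianProductWith⁻ (grid 𝒞₁ K) T T ij∈
  ... | t , u , t∈T , u∈T , refl =
    cong₂ _∧_ (from (ones _) (∈-map⁺ (centre K) t∈T)) (from (ones _) (∈-map⁺ (centre K) u∈T))
lift-ones 𝒞₂ {a} {K} {T} ones i j = mk⇔ ones-are-listed listed-are-ones
  where
  ones-are-listed : a (i + j) ∧ a (i - j) ≡ true → (i , j) ∈ cartesianProductWith (grid 𝒞₂ K) T T
  ones-are-listed aij with ∈-map⁻ (centre K) (to (ones (i + j)) (proj₁ (∧-true aij)))
                         | ∈-map⁻ (centre K) (to (ones (i - j)) (proj₂ (∧-true aij)))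
  ... | t , t∈T , s≡ | u , u∈T , d≡ =
    subst (_∈ cartesianProductWith (grid 𝒞₂ K) T T) (sym (cong₂ _,_ i≡ j≡))
          (∈-cartesianProductWith⁺ (grid 𝒞₂ K) t∈T u∈T)
    where
    i≡ : i ≡ t + u - K
    i≡ = double-injective (begin
      + 2 * i                     ≡⟨ proj₁ (rotation i j) ⟩
      (i + j) + (i - j)           ≡⟨ cong₂ _+_ s≡ d≡ ⟩
      centre K t + centre K u     ≡⟨ proj₁ (centre-rotation K t u) ⟩
      + 2 * (t + u - K)           ∎)
    j≡ : j ≡ t - u
    j≡ = double-injective (begin
      + 2 * j                     ≡⟨ proj₂ (rotation i j) ⟩
      (i + j) - (i - j)           ≡⟨ cong₂ _-_ s≡ d≡ ⟩
      centre K t - centre K u     ≡⟨ proj₂ (centre-rotation K t u) ⟩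
      + 2 * (t - u)               ∎)
  listed-are-ones : (i , j) ∈ cartesianProductWith (grid 𝒞₂ K) T T → a (i + j) ∧ a (i - j) ≡ true
  listed-are-ones ij∈ with ∈-cartesianProductWith⁻ (grid 𝒞₂ K) T T ij∈
  ... | t , u , t∈T , u∈T , ij≡ = cong₂ _∧_
    (from (ones _) (∈-map-at t∈T (trans (cong₂ _+_ i≡ j≡) (proj₁ (grid-rotation K t u)))))
    (from (ones _) (∈-map-at u∈T (trans (cong₂ _-_ i≡ j≡) (proj₂ (grid-rotation K t u)))))
    where
    i≡ : i ≡ t + u - K
    i≡ = cong proj₁ ij≡
    j≡ : j ≡ t - u
    j≡ = cong proj₂ ij≡

initial-product : initial ≗₂ lift 𝒞₁ isZero
initial-product i j with isZero i | isZero j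
... | true  | true  = refl
... | true  | false = refl
... | false | _     = refl

initial-lift : ∀ 𝒞 → initial ≗₂ lift 𝒞 isZero
initial-lift 𝒞₁ = initial-product
initial-lift 𝒞₂ i j = trans (initial-product i j)
  (Bool-ext (⇔-sym (lift-ones 𝒞₂ {K = + 0} {T = origin} ones i j)
             ⇔-∘ lift-ones 𝒞₁ {K = + 0} {T = origin} ones i j))
  where
  open RowCensus census-zero renaming (indices to origin)

length-cartesianProductWith : ∀ {A B C : Set} (g : A → B → C) xs ys →
  length (cartesianProductWith g xs ys) ≡ length xs ℕ.* length ys
length-cartesianProductWith g []       ys = refl
length-cartesianProductWith g (x ∷ xs) ys = begin
  length (map (g x) ys ++ cartesianProductWith g xs ys)         ≡⟨ length-++ (map (g x) ys) ⟩
  length (map (g x) ys) ℕ.+ length (cartesianProductWith g xs ys)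
    ≡⟨ cong₂ ℕ._+_ (length-map (g x) ys) (length-cartesianProductWith g xs ys) ⟩
  length ys ℕ.+ length xs ℕ.* length ys                         ∎

square-of-power-of-2 : ∀ n → 2 ^ n ℕ.* 2 ^ n ≡ 4 ^ n
square-of-power-of-2 zero    = refl
square-of-power-of-2 (suc n) = trans (rearrange (2 ^ n)) (cong (4 ℕ.*_) (square-of-power-of-2 n))
  where
  rearrange : ∀ x → (2 ℕ.* x) ℕ.* (2 ℕ.* x) ≡ 4 ℕ.* (x ℕ.* x)
  rearrange = ℕSolver.solve-∀

≡true-cong : ∀ {b c} → b ≡ c → (b ≡ true ⇔ c ≡ true)
≡true-cong b≡c = mk⇔ (trans (sym b≡c)) (trans b≡c)

mainTheorem7 : (𝒞 : Automaton) (k : ℕ) →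
    NumOnes (iterate (step 𝒞) k initial) (4 ^ ℓ k)
mainTheorem7 𝒞 k =
  cartesianProductWith (grid 𝒞 K) indices indices ,
  cartesianProductWith⁺ (grid 𝒞 K) (grid-injective 𝒞 K) unique unique ,
  (λ i j → lift-ones 𝒞 ones i j ⇔-∘ ≡true-cong (iterate-lift 𝒞 (initial-lift 𝒞) k i j)) ,
  (begin
    length (cartesianProductWith (grid 𝒞 K) indices indices)   ≡⟨ length-cartesianProductWith (grid 𝒞 K) indices indices ⟩
    length indices ℕ.* length indices                          ≡⟨ cong₂ ℕ._*_ size size ⟩
    2 ^ ℓ k ℕ.* 2 ^ ℓ k                                        ≡⟨ square-of-power-of-2 (ℓ k) ⟩
    4 ^ ℓ k                                                    ∎)
  where
  open RowCensus (census (binary k))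
  K : ℤ
  K = + k
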